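{- Let $\mathsf{n}$ be a linearly independent tuple of linear subspaces of a finite-dimensional vector space $V$ over a field $\mathbb{K}$, and let $\mathsf{k},\mathsf{h}$ be BK-subtuples of $\mathsf{n}$. Then $\mathsf{k}\cup\mathsf{h}$ and $\mathsf{k}\cap\mathsf{h}$ are BK-subtuples of $\mathsf{n}$.
   Context: A tuple is a finite indexed family of linear subspaces of $V$ (repetitions allowed); a subtuple is a subfamily indexed by a subset of the index set, and unions and intersections of subtuples are taken on index sets. For a tuple $\mathsf{k}$, $\langle\mathsf{k}\rangle=\sum_{L\in\mathsf{k}}L$ (zero for the empty tuple), $\mathfrak{c}(\mathsf{k})$ is the number of its entries, and $\delta(\mathsf{k})=\dim\langle\mathsf{k}\rangle-\mathfrak{c}(\mathsf{k})$ is its defect. A tuple is linearly independent if every subtuple (including itself) has non-negative defect. A BK-tuple is a linearly independent tuple with defect $0$. -}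

module Defs where

open import Level using (Level; _⊔_) renaming (suc to lsuc)
open import Data.Nat using (ℕ; zero; suc; _≤_)
open import Data.Fin using (Fin; zero; suc)
open import Data.Fin.Subset using (Subset; _∈_; _∉_; _⊆_; ∣_∣)
open import Data.Product using (Σ; ∃; _×_; _,_)
open import Function using (_∘_)
open import Relation.Nullary using (¬_)
open import Algebra.Bundles using (CommutativeRing)
open import Algebra.Module.Bundles using (Module)

record Field (c ℓ : Level) : Set (lsuc (c ⊔ ℓ)) where
  field
    commutativeRing : CommutativeRing c ℓ
  open CommutativeRing commutativeRing public
  field
    1≉0     : ¬ (1# ≈ 0#)
    inverse : ∀ x → ¬ (x ≈ 0#) → ∃ λ y → x * y ≈ 1#

module LinAlg {c ℓ : Level} (F : Field c ℓ)
              {m ℓm : Level} (M : Module (Field.commutativeRing F) m ℓm) where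

  open Field F using (Carrier; _≈_; 0#)
  open Module M using (Carrierᴹ; _≈ᴹ_; _+ᴹ_; _*ₗ_; 0ᴹ)

  ∑ : ∀ {k} → (Fin k → Carrierᴹ) → Carrierᴹ
  ∑ {zero}  _ = 0ᴹ
  ∑ {suc k} f = f zero +ᴹ ∑ (f ∘ suc)

  lincomb : ∀ {k} → (Fin k → Carrier) → (Fin k → Carrierᴹ) → Carrierᴹ
  lincomb a v = ∑ (λ i → a i *ₗ v i)

  record Subspace (p : Level) : Set (c ⊔ m ⊔ ℓm ⊔ lsuc p) where
    field
      mem    : Carrierᴹ → Set p
      resp   : ∀ {x y} → x ≈ᴹ y → mem x → mem y
      zero∈  : mem 0ᴹ
      +-closed : ∀ {x y} → mem x → mem y → mem (x +ᴹ y)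
      *-closed : ∀ a {x} → mem x → mem (a *ₗ x)
  open Subspace public

  Independent : ∀ {k} → (Fin k → Carrierᴹ) → Set (c ⊔ ℓ ⊔ ℓm)
  Independent v = ∀ a → lincomb a v ≈ᴹ 0ᴹ → ∀ i → a i ≈ 0#

  FiniteDimensional : Set (c ⊔ m ⊔ ℓm)
  FiniteDimensional =
    Σ ℕ λ k → Σ (Fin k → Carrierᴹ) λ v → ∀ x → ∃ λ a → x ≈ᴹ lincomb a v

  HasDim : ∀ {p} → (Carrierᴹ → Set p) → ℕ → Set (c ⊔ ℓ ⊔ m ⊔ ℓm ⊔ p)
  HasDim W d = Σ (Fin d → Carrierᴹ) λ v →
      (∀ i → W (v i))
    × Independent v
    × (∀ x → W x → ∃ λ a → x ≈ᴹ lincomb a v)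

  module Tuple {p : Level} {N : ℕ} (n : Fin N → Subspace p) where

    ⟨_⟩ : Subset N → Carrierᴹ → Set (m ⊔ ℓm ⊔ p)
    ⟨ S ⟩ x = Σ (Fin N → Carrierᴹ) λ w →
        (∀ i → i ∈ S → mem (n i) (w i))
      × (∀ i → i ∉ S → w i ≈ᴹ 0ᴹ)
      × x ≈ᴹ ∑ w

    -- defect δ(S) = dim ⟨S⟩ − 𝔠(S) is non-negative
    DefectNonNeg : Subset N → Set (c ⊔ ℓ ⊔ m ⊔ ℓm ⊔ p)
    DefectNonNeg S = Σ ℕ λ d → HasDim ⟨ S ⟩ d × ∣ S ∣ ≤ d

    DefectZero : Subset N → Set (c ⊔ ℓ ⊔ m ⊔ ℓm ⊔ p)
    DefectZero S = HasDim ⟨ S ⟩ ∣ S ∣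

    LinIndep : Subset N → Set (c ⊔ ℓ ⊔ m ⊔ ℓm ⊔ p)
    LinIndep S = ∀ T → T ⊆ S → DefectNonNeg T

    IsBK : Subset N → Set (c ⊔ ℓ ⊔ m ⊔ ℓm ⊔ p)
    IsBK S = LinIndep S × DefectZero S

{-# OPTIONS --safe #-}
-- Because n is linearly independent, ⟨k ∪ h⟩ and ⟨k ∩ h⟩ have bases of d ≥ ∣k ∪ h∣ and
-- d′ ≥ ∣k ∩ h∣ vectors. As ⟨k ∪ h⟩ = ⟨k⟩ + ⟨h⟩ and ⟨k ∩ h⟩ ⊆ ⟨k⟩ ∩ ⟨h⟩, a Grassmann-type
-- inequality gives d + d′ ≤ ∣k∣ + ∣h∣ = ∣k ∪ h∣ + ∣k ∩ h∣, so both lower bounds are attained.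
-- That inequality comes from the Steinitz exchange lemma, applied twice: the d′ independent
-- vectors of ⟨k ∩ h⟩ replace d′ of the ∣k∣ basis vectors of ⟨k⟩, and the e ≤ ∣k∣ − d′ remaining
-- ones span ⟨k⟩ together with ⟨k ∩ h⟩ ⊆ ⟨h⟩; so they and the basis of ⟨h⟩ span ⟨k ∪ h⟩, whence
-- d ≤ e + ∣h∣.
-- Equality of scalars is not decidable, so the exchange lemma only holds under double negation;
-- this costs nothing, as all its uses conclude inequalities between natural numbers.
module Submission where

open import Defs
open import Level using (Level; _⊔_)
open import Data.Nat using (ℕ; zero; suc; _+_; _≤_; _<_; _≤?_; s≤s)
open import Data.Nat.Properties
  using (≤-refl; ≤-trans; ≤-reflexive; ≤-antisym; m≤m+n; +-suc; +-comm; +-assoc;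
         +-monoˡ-≤; +-monoʳ-≤; +-cancelˡ-≤; +-cancelʳ-≤; module ≤-Reasoning)
open import Data.Fin using (Fin; zero; suc; _↑ˡ_; _↑ʳ_)
open import Data.Product using (Σ-syntax; ∃; _×_; _,_)
open import Data.Sum using (inj₁; inj₂; [_,_])
open import Function using (_∘_)
open import Relation.Nullary using (¬_; yes; no)
open import Relation.Nullary.Decidable using (decidable-stable; ¬¬-excluded-middle)
open import Relation.Nullary.Negation using (¬¬-map; negated-stable; contradiction)
open import Relation.Binary.PropositionalEquality using (_≡_; refl; sym; trans; cong; subst)
open import Algebra.Bundles using (CommutativeMonoid)
open import Algebra.Module.Bundles using (Module)
import Algebra.Module.Properties as ModuleProperties
import Algebra.Properties.CommutativeSemigroup as CommutativeSemigroupProperties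
import Algebra.Properties.Ring as RingProperties
import Relation.Binary.Reasoning.Setoid as SetoidReasoning

private
  variable
    ℓ₁ ℓ₂ : Level
    A : Set ℓ₁
    B : Set ℓ₂

  -- ¬¬-Monad is a RawMonad, so its bind cannot change universe level.
  _>>=_ : ¬ ¬ A → (A → ¬ ¬ B) → ¬ ¬ B
  ¬¬a >>= f = negated-stable (¬¬-map f ¬¬a)

  pure : A → ¬ ¬ A
  pure = contradiction

≤-+-squeeze : ∀ {m n o p} → m ≤ o → n ≤ p → o + p ≤ m + n → o ≡ m × p ≡ n
≤-+-squeeze {m} {n} {o} {p} m≤o n≤p o+p≤m+n =
  ≤-antisym (+-cancelʳ-≤ p o m (≤-trans o+p≤m+n (+-monoʳ-≤ m n≤p))) m≤o ,
  ≤-antisym (+-cancelˡ-≤ o p n (≤-trans o+p≤m+n (+-monoˡ-≤ n m≤o))) n≤p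

module FiniteSpans {c ℓ : Level} (F : Field c ℓ) {m ℓm : Level}
                   (M : Module (Field.commutativeRing F) m ℓm) where

  open import Data.Vec.Functional using (Vector; _∷_; head; tail; _++_)
  open import Data.Vec.Functional.Properties using (lookup-++ˡ; lookup-++ʳ)
  open import Relation.Unary using (Pred; _⊆_; _∪_; ｛_｝)

  open Field F using (Carrier; _≈_; _*_; -_; 0#; 1#; 1≉0; inverse; *-comm; -‿inverseˡ; ring)
    renaming (_+_ to _+ᶠ_; sym to ≈-sym; trans to ≈-trans)
  open Module M
  open LinAlg F M
  open ModuleProperties M using (x≈0⇒x*y≈0)
  open RingProperties ring using (-0#≈0#; -‿injective)
  open CommutativeSemigroupProperties
    (CommutativeMonoid.commutativeSemigroup +ᴹ-commutativeMonoid) using (interchange)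

  private
    variable
      k : ℕ
      ℓP ℓQ : Level
      x y g : Carrierᴹ
      G H : Pred Carrierᴹ m

  ∑-cong : {f f′ : Vector Carrierᴹ k} → (∀ i → f i ≈ᴹ f′ i) → ∑ f ≈ᴹ ∑ f′
  ∑-cong {zero}  _     = ≈ᴹ-refl
  ∑-cong {suc k} f≈f′ = +ᴹ-cong (f≈f′ zero) (∑-cong (f≈f′ ∘ suc))

  ∑-distrib-+ᴹ : (f f′ : Vector Carrierᴹ k) → ∑ (λ i → f i +ᴹ f′ i) ≈ᴹ ∑ f +ᴹ ∑ f′
  ∑-distrib-+ᴹ {zero}  _ _  = ≈ᴹ-sym (+ᴹ-identityˡ 0ᴹ)
  ∑-distrib-+ᴹ {suc k} f f′ =
    ≈ᴹ-trans (+ᴹ-congˡ (∑-distrib-+ᴹ (tail f) (tail f′))) (interchange _ _ _ _)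

  *ₗ-distrib-∑ : ∀ r (f : Vector Carrierᴹ k) → r *ₗ ∑ f ≈ᴹ ∑ (λ i → r *ₗ f i)
  *ₗ-distrib-∑ {zero}  r _ = *ₗ-zeroʳ r
  *ₗ-distrib-∑ {suc k} r f = ≈ᴹ-trans (*ₗ-distribˡ r _ _) (+ᴹ-congˡ (*ₗ-distrib-∑ r (tail f)))

  lincomb-zero : (v : Vector Carrierᴹ k) → lincomb (λ _ → 0#) v ≈ᴹ 0ᴹ
  lincomb-zero {zero}  _ = ≈ᴹ-refl
  lincomb-zero {suc k} v =
    ≈ᴹ-trans (+ᴹ-cong (*ₗ-zeroˡ (head v)) (lincomb-zero (tail v))) (+ᴹ-identityˡ 0ᴹ)

  lincomb-+ : (α β : Vector Carrier k) (v : Vector Carrierᴹ k) →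
              lincomb (λ i → α i +ᶠ β i) v ≈ᴹ lincomb α v +ᴹ lincomb β v
  lincomb-+ α β v = ≈ᴹ-trans (∑-cong λ i → *ₗ-distribʳ (v i) (α i) (β i))
                             (∑-distrib-+ᴹ (λ i → α i *ₗ v i) (λ i → β i *ₗ v i))

  lincomb-* : ∀ r (α : Vector Carrier k) (v : Vector Carrierᴹ k) →
              lincomb (λ i → r * α i) v ≈ᴹ r *ₗ lincomb α v
  lincomb-* r α v = ≈ᴹ-trans (∑-cong λ i → *ₗ-assoc r (α i) (v i))
                             (≈ᴹ-sym (*ₗ-distrib-∑ r (λ i → α i *ₗ v i)))

  kronecker : Fin k → Vector Carrier k
  kronecker zero    zero    = 1#
  kronecker zero    (suc _) = 0#
  kronecker (suc _) zero    = 0#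
  kronecker (suc i) (suc j) = kronecker i j

  lincomb-kronecker : ∀ i (v : Vector Carrierᴹ k) → lincomb (kronecker i) v ≈ᴹ v i
  lincomb-kronecker zero    v =
    ≈ᴹ-trans (+ᴹ-cong (*ₗ-identityˡ (head v)) (lincomb-zero (tail v))) (+ᴹ-identityʳ (head v))
  lincomb-kronecker (suc i) v =
    ≈ᴹ-trans (+ᴹ-cong (*ₗ-zeroˡ (head v)) (lincomb-kronecker i (tail v))) (+ᴹ-identityˡ (v (suc i)))

  -1*ₗx+x≈0 : ∀ x → (- 1#) *ₗ x +ᴹ x ≈ᴹ 0ᴹ
  -1*ₗx+x≈0 x = begin
    (- 1#) *ₗ x +ᴹ x        ≈⟨ +ᴹ-congˡ (*ₗ-identityˡ x) ⟨
    (- 1#) *ₗ x +ᴹ 1# *ₗ x  ≈⟨ *ₗ-distribʳ x (- 1#) 1# ⟨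
    (- 1# +ᶠ 1#) *ₗ x       ≈⟨ *ₗ-congʳ (-‿inverseˡ 1#) ⟩
    0# *ₗ x                 ≈⟨ *ₗ-zeroˡ x ⟩
    0ᴹ                      ∎
    where open SetoidReasoning ≈ᴹ-setoid

  Range : Vector Carrierᴹ k → Pred Carrierᴹ m
  Range v y = ∃ λ i → v i ≡ y

  Range-⊆ : {P : Pred Carrierᴹ ℓP} {v : Vector Carrierᴹ k} → (∀ i → P (v i)) → Range v ⊆ P
  Range-⊆ Pv (i , refl) = Pv i

  _+ᴾ_ : Pred Carrierᴹ ℓP → Pred Carrierᴹ ℓQ → Pred Carrierᴹ (m ⊔ ℓm ⊔ ℓP ⊔ ℓQ)
  (P +ᴾ Q) x = Σ[ y ∈ Carrierᴹ ] Σ[ z ∈ Carrierᴹ ] P y × Q z × x ≈ᴹ y +ᴹ z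

  data Span (G : Pred Carrierᴹ m) : Pred Carrierᴹ (c ⊔ m ⊔ ℓm) where
    gen : G x → Span G x
    0∈  : Span G 0ᴹ
    +∈  : Span G x → Span G y → Span G (x +ᴹ y)
    *∈  : ∀ r → Span G x → Span G (r *ₗ x)
    ≈∈  : x ≈ᴹ y → Span G x → Span G y

  ⊆Span⇒Span⊆ : G ⊆ Span H → Span G ⊆ Span H
  ⊆Span⇒Span⊆ G⊆ (gen x∈G)  = G⊆ x∈G
  ⊆Span⇒Span⊆ G⊆ 0∈         = 0∈
  ⊆Span⇒Span⊆ G⊆ (+∈ s t)   = +∈ (⊆Span⇒Span⊆ G⊆ s) (⊆Span⇒Span⊆ G⊆ t)
  ⊆Span⇒Span⊆ G⊆ (*∈ r s)   = *∈ r (⊆Span⇒Span⊆ G⊆ s)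
  ⊆Span⇒Span⊆ G⊆ (≈∈ x≈y s) = ≈∈ x≈y (⊆Span⇒Span⊆ G⊆ s)

  Span-mono : G ⊆ H → Span G ⊆ Span H
  Span-mono G⊆H = ⊆Span⇒Span⊆ (λ x∈G → gen (G⊆H x∈G))

  +ᴾ⊆Span : {P : Pred Carrierᴹ ℓP} {Q : Pred Carrierᴹ ℓQ} →
            P ⊆ Span G → Q ⊆ Span G → P +ᴾ Q ⊆ Span G
  +ᴾ⊆Span P⊆ Q⊆ (_ , _ , y∈P , z∈Q , x≈y+z) = ≈∈ (≈ᴹ-sym x≈y+z) (+∈ (P⊆ y∈P) (Q⊆ z∈Q))

  lincomb∈Span : (α : Vector Carrier k) (v : Vector Carrierᴹ k) → Span (Range v) (lincomb α v)
  lincomb∈Span {zero}  _ _ = 0∈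
  lincomb∈Span {suc k} α v =
    +∈ (*∈ (head α) (gen (zero , refl)))
       (Span-mono (λ (i , eq) → suc i , eq) (lincomb∈Span (tail α) (tail v)))

  Span⇒lincomb : {v : Vector Carrierᴹ k} → Span (Range v) x → ∃ λ α → x ≈ᴹ lincomb α v
  Span⇒lincomb {v = v} (gen (i , refl)) = kronecker i , ≈ᴹ-sym (lincomb-kronecker i v)
  Span⇒lincomb {v = v} 0∈               = (λ _ → 0#) , ≈ᴹ-sym (lincomb-zero v)
  Span⇒lincomb {v = v} (+∈ s t) =
    let α , x≈ = Span⇒lincomb s
        β , y≈ = Span⇒lincomb t
    in (λ i → α i +ᶠ β i) , ≈ᴹ-trans (+ᴹ-cong x≈ y≈) (≈ᴹ-sym (lincomb-+ α β v))
  Span⇒lincomb {v = v} (*∈ r s) =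
    let α , x≈ = Span⇒lincomb s
    in (λ i → r * α i) , ≈ᴹ-trans (*ₗ-congˡ x≈) (≈ᴹ-sym (lincomb-* r α v))
  Span⇒lincomb (≈∈ x≈y s) =
    let α , x≈ = Span⇒lincomb s
    in α , ≈ᴹ-trans (≈ᴹ-sym x≈y) x≈

  ⊆lincombs⇒⊆Span : {W : Pred Carrierᴹ ℓP} {v : Vector Carrierᴹ k} →
                    (∀ x → W x → ∃ λ α → x ≈ᴹ lincomb α v) → W ⊆ Span (Range v)
  ⊆lincombs⇒⊆Span {v = v} W⊆ {x} x∈W =
    let α , x≈ = W⊆ x x∈W in ≈∈ (≈ᴹ-sym x≈) (lincomb∈Span α v)

  x≈x+0*ₗv : ∀ x v → x ≈ᴹ x +ᴹ 0# *ₗ v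
  x≈x+0*ₗv x v = ≈ᴹ-sym (≈ᴹ-trans (+ᴹ-congˡ (*ₗ-zeroˡ v)) (+ᴹ-identityʳ x))

  Span-insert⁻ : ∀ {v} → Span (｛ v ｝ ∪ G) x →
                 Σ[ r ∈ Carrier ] Σ[ g ∈ Carrierᴹ ] Span G g × x ≈ᴹ g +ᴹ r *ₗ v
  Span-insert⁻ {v = v} (gen (inj₁ refl)) =
    1# , 0ᴹ , 0∈ , ≈ᴹ-sym (≈ᴹ-trans (+ᴹ-identityˡ _) (*ₗ-identityˡ v))
  Span-insert⁻ {x = x} {v = v} (gen (inj₂ x∈G)) = 0# , x , gen x∈G , x≈x+0*ₗv x v
  Span-insert⁻ {v = v} 0∈ = 0# , 0ᴹ , 0∈ , x≈x+0*ₗv 0ᴹ v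
  Span-insert⁻ {v = v} (+∈ s t) =
    let r , g , g∈ , x≈ = Span-insert⁻ s
        r′ , g′ , g′∈ , y≈ = Span-insert⁻ t
    in r +ᶠ r′ , g +ᴹ g′ , +∈ g∈ g′∈ ,
       ≈ᴹ-trans (+ᴹ-cong x≈ y≈)
         (≈ᴹ-trans (interchange _ _ _ _) (+ᴹ-congˡ (≈ᴹ-sym (*ₗ-distribʳ v r r′))))
  Span-insert⁻ {v = v} (*∈ a s) =
    let r , g , g∈ , x≈ = Span-insert⁻ s
    in a * r , a *ₗ g , *∈ a g∈ ,
       ≈ᴹ-trans (*ₗ-congˡ x≈)
         (≈ᴹ-trans (*ₗ-distribˡ a _ _) (+ᴹ-congˡ (≈ᴹ-sym (*ₗ-assoc a r v))))
  Span-insert⁻ (≈∈ x≈y s) =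
    let r , g , g∈ , x≈ = Span-insert⁻ s
    in r , g , g∈ , ≈ᴹ-trans (≈ᴹ-sym x≈y) x≈

  Span-solve : ∀ {r v} → ¬ r ≈ 0# → x ≈ᴹ g +ᴹ r *ₗ v → Span H x → Span H g → Span H v
  Span-solve {x} {g} {r = r} {v} r≉0 x≈ x∈ g∈ =
    let r⁻¹ , rr⁻¹≈1 = inverse r r≉0
    in ≈∈ (v≈ r⁻¹ rr⁻¹≈1) (*∈ r⁻¹ (+∈ (*∈ (- 1#) g∈) x∈))
    where
    open SetoidReasoning ≈ᴹ-setoid
    v≈ : ∀ s → r * s ≈ 1# → s *ₗ ((- 1#) *ₗ g +ᴹ x) ≈ᴹ v
    v≈ s rs≈1 = begin
      s *ₗ ((- 1#) *ₗ g +ᴹ x)               ≈⟨ *ₗ-congˡ (+ᴹ-congˡ x≈) ⟩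
      s *ₗ ((- 1#) *ₗ g +ᴹ (g +ᴹ r *ₗ v))   ≈⟨ *ₗ-congˡ (+ᴹ-assoc _ _ _) ⟨
      s *ₗ (((- 1#) *ₗ g +ᴹ g) +ᴹ r *ₗ v)   ≈⟨ *ₗ-congˡ (+ᴹ-congʳ (-1*ₗx+x≈0 g)) ⟩
      s *ₗ (0ᴹ +ᴹ r *ₗ v)                   ≈⟨ *ₗ-congˡ (+ᴹ-identityˡ _) ⟩
      s *ₗ (r *ₗ v)                         ≈⟨ *ₗ-assoc s r v ⟨
      (s * r) *ₗ v                          ≈⟨ *ₗ-congʳ (≈-trans (*-comm s r) rs≈1) ⟩
      1# *ₗ v                               ≈⟨ *ₗ-identityˡ v ⟩
      v                                     ∎

  Independent-tail : (v : Vector Carrierᴹ (suc k)) → Independent v → Independent (tail v)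
  Independent-tail v v-indep α α·v≈0 i =
    v-indep (0# ∷ α) (≈ᴹ-trans (+ᴹ-cong (*ₗ-zeroˡ (head v)) α·v≈0) (+ᴹ-identityˡ 0ᴹ)) (suc i)

  Independent⇒head∉Span : (v : Vector Carrierᴹ (suc k)) →
                          Independent v → ¬ Span (Range (tail v)) (head v)
  Independent⇒head∉Span v v-indep v₀∈ =
    let α , v₀≈ = Span⇒lincomb v₀∈
        -1≈0 = v-indep (- 1# ∷ α) (≈ᴹ-trans (+ᴹ-congˡ (≈ᴹ-sym v₀≈)) (-1*ₗx+x≈0 (head v))) zero
    in 1≉0 (-‿injective (≈-trans -1≈0 (≈-sym -0#≈0#)))

  Completion : (ℕ → Set) → Pred Carrierᴹ m → Vector Carrierᴹ k → Set (c ⊔ m ⊔ ℓm)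
  Completion Small G u =
    Σ[ e ∈ ℕ ] Σ[ u′ ∈ Vector Carrierᴹ e ] Small e × Range u ⊆ Span (G ∪ Range u′)

  exchange : ∀ {e} (u : Vector Carrierᴹ e) → Span (G ∪ Range u) x → ¬ Span G x →
             ¬ ¬ Completion (_< e) (G ∪ ｛ x ｝) u
  exchange {e = zero} _ x∈ x∉ =
    contradiction (Span-mono [ (λ x∈G → x∈G) , (λ ()) ] x∈) x∉
  exchange {G = G} {x = x} {e = suc e} u x∈ x∉ =
    let r , g , g∈ , x≈ = Span-insert⁻ (Span-mono isolate-head x∈)
    in ¬¬-excluded-middle >>= λ where
      (no r≉0)  → pure (head-replaced r≉0 x≈ g∈)
      (yes r≈0) → ¬¬-map head-kept (exchange (tail u) (≈∈ (g≈x x≈ r≈0) g∈) x∉)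
    where
    isolate-head : G ∪ Range u ⊆ ｛ head u ｝ ∪ (G ∪ Range (tail u))
    isolate-head (inj₁ x∈G)         = inj₂ (inj₁ x∈G)
    isolate-head (inj₂ (zero , eq))  = inj₁ eq
    isolate-head (inj₂ (suc i , eq)) = inj₂ (inj₂ (i , eq))
    g≈x : ∀ {g r} → x ≈ᴹ g +ᴹ r *ₗ head u → r ≈ 0# → g ≈ᴹ x
    g≈x x≈ r≈0 = ≈ᴹ-sym (≈ᴹ-trans x≈ (≈ᴹ-trans (+ᴹ-congˡ (x≈0⇒x*y≈0 r≈0)) (+ᴹ-identityʳ _)))
    head-replaced : ∀ {g r} → ¬ r ≈ 0# → x ≈ᴹ g +ᴹ r *ₗ head u →
                    Span (G ∪ Range (tail u)) g → Completion (_< suc e) (G ∪ ｛ x ｝) u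
    head-replaced r≉0 x≈ g∈ = e , tail u , ≤-refl , λ where
      (zero , refl)  →
        Span-solve r≉0 x≈ (gen (inj₁ (inj₂ refl))) (Span-mono [ inj₁ ∘ inj₁ , inj₂ ] g∈)
      (suc j , refl) → gen (inj₂ (j , refl))
    head-kept : Completion (_< e) (G ∪ ｛ x ｝) (tail u) → Completion (_< suc e) (G ∪ ｛ x ｝) u
    head-kept (e′ , u′ , e′<e , tail-u⊆) = suc e′ , head u ∷ u′ , s≤s e′<e , λ where
      (zero , refl)  → gen (inj₂ (zero , refl))
      (suc j , refl) → Span-mono [ inj₁ , (λ (i , eq) → inj₂ (suc i , eq)) ] (tail-u⊆ (j , refl))

  steinitz : ∀ {a e} (z : Vector Carrierᴹ a) (u : Vector Carrierᴹ e) →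
             Independent z → Range z ⊆ Span (Range u) →
             ¬ ¬ Completion (λ e′ → a + e′ ≤ e) (Range z) u
  steinitz {zero} _ u _ _ = pure (_ , u , ≤-refl , λ {_} t → gen (inj₂ t))
  steinitz {suc a} {e} z u z-indep z⊆ =
    steinitz (tail z) u (Independent-tail z z-indep) (λ (i , eq) → z⊆ (suc i , eq))
      >>= λ (e′ , u′ , a+e′≤e , u⊆) →
    ¬¬-map (insert-head a+e′≤e u⊆)
      (exchange u′ (⊆Span⇒Span⊆ u⊆ (z⊆ (zero , refl))) (Independent⇒head∉Span z z-indep))
    where
    insert-head : ∀ {e′} {u′ : Vector Carrierᴹ e′} →
                  a + e′ ≤ e → Range u ⊆ Span (Range (tail z) ∪ Range u′) →
                  Completion (_< e′) (Range (tail z) ∪ ｛ head z ｝) u′ →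
                  Completion (λ e″ → suc a + e″ ≤ e) (Range z) u
    insert-head {u′ = u′} a+e′≤e u⊆ (e″ , u″ , e″<e′ , u′⊆) =
      e″ , u″ ,
      ≤-trans (≤-reflexive (sym (+-suc a e″))) (≤-trans (+-monoʳ-≤ a e″<e′) a+e′≤e) ,
      λ t → ⊆Span⇒Span⊆ regroup (u⊆ t)
      where
      merge : (Range (tail z) ∪ ｛ head z ｝) ∪ Range u″ ⊆ Range z ∪ Range u″
      merge (inj₁ (inj₁ (i , eq))) = inj₁ (suc i , eq)
      merge (inj₁ (inj₂ eq))       = inj₁ (zero , eq)
      merge (inj₂ t)               = inj₂ t
      regroup : Range (tail z) ∪ Range u′ ⊆ Span (Range z ∪ Range u″)
      regroup (inj₁ (i , eq)) = gen (inj₁ (suc i , eq))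
      regroup (inj₂ t)        = Span-mono merge (u′⊆ t)

  steinitz-≤ : ∀ {a e} (z : Vector Carrierᴹ a) (u : Vector Carrierᴹ e) →
               Independent z → Range z ⊆ Span (Range u) → a ≤ e
  steinitz-≤ {a} {e} z u z-indep z⊆ =
    decidable-stable (a ≤? e)
      (¬¬-map (λ (_ , _ , a+e′≤e , _) → ≤-trans (m≤m+n a _) a+e′≤e) (steinitz z u z-indep z⊆))

  grassmann-≤ : ∀ {a b d d′} {K : Pred Carrierᴹ ℓP} {H : Pred Carrierᴹ ℓQ}
                (uK : Vector Carrierᴹ a) (uH : Vector Carrierᴹ b)
                {y : Vector Carrierᴹ d} {z : Vector Carrierᴹ d′} →
                K ⊆ Span (Range uK) → H ⊆ Span (Range uH) →
                Independent y → Range y ⊆ K +ᴾ H →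
                Independent z → Range z ⊆ K → Range z ⊆ H →
                d + d′ ≤ a + b
  grassmann-≤ {a = a} {b} {d} {d′} {K} {H} uK uH {y} {z} K⊆ H⊆ y-indep y⊆ z-indep z⊆K z⊆H =
    decidable-stable (d + d′ ≤? a + b) (¬¬-map bound (steinitz z uK z-indep (K⊆ ∘ z⊆K)))
    where
    bound : Completion (λ e → d′ + e ≤ a) (Range z) uK → d + d′ ≤ a + b
    bound (e , u′ , d′+e≤a , uK⊆) = begin
      d + d′        ≡⟨ +-comm d d′ ⟩
      d′ + d        ≤⟨ +-monoʳ-≤ d′ (steinitz-≤ y (u′ ++ uH) y-indep (+ᴾ⊆Span K⊆′ H⊆′ ∘ y⊆)) ⟩
      d′ + (e + b)  ≡⟨ +-assoc d′ e b ⟨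
      d′ + e + b    ≤⟨ +-monoˡ-≤ b d′+e≤a ⟩
      a + b         ∎
      where
      open ≤-Reasoning
      u′⊆ : Range u′ ⊆ Range (u′ ++ uH)
      u′⊆ (i , refl) = i ↑ˡ b , lookup-++ˡ u′ uH i
      uH⊆ : Range uH ⊆ Range (u′ ++ uH)
      uH⊆ (i , refl) = e ↑ʳ i , lookup-++ʳ u′ uH i
      H⊆′ : H ⊆ Span (Range (u′ ++ uH))
      H⊆′ = Span-mono uH⊆ ∘ H⊆
      K⊆′ : K ⊆ Span (Range (u′ ++ uH))
      K⊆′ = ⊆Span⇒Span⊆ (⊆Span⇒Span⊆ [ H⊆′ ∘ z⊆H , gen ∘ u′⊆ ] ∘ uK⊆) ∘ K⊆

-- Imported only after FiniteSpans, whose _∪_ (on predicates) and _∷_ (on functional vectors)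
-- these would clash with.
open import Data.Vec using ([]; _∷_)
open import Data.Fin.Subset as Subset using (Subset; ⊤; _∪_; _∩_; _∈_; _∉_; ∣_∣; inside; outside)
open import Data.Fin.Subset.Properties using (_∈?_; ⊆⊤; x∈p∪q⁺; x∈p∪q⁻; p∩q⊆p; p∩q⊆q)

∣p∪q∣+∣p∩q∣≡∣p∣+∣q∣ : ∀ {N} (p q : Subset N) → ∣ p ∪ q ∣ + ∣ p ∩ q ∣ ≡ ∣ p ∣ + ∣ q ∣
∣p∪q∣+∣p∩q∣≡∣p∣+∣q∣ []            []            = refl
∣p∪q∣+∣p∩q∣≡∣p∣+∣q∣ (inside ∷ p)  (inside ∷ q)  =
  cong suc (trans (+-suc ∣ p ∪ q ∣ ∣ p ∩ q ∣)
                  (trans (cong suc (∣p∪q∣+∣p∩q∣≡∣p∣+∣q∣ p q)) (sym (+-suc ∣ p ∣ ∣ q ∣))))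
∣p∪q∣+∣p∩q∣≡∣p∣+∣q∣ (inside ∷ p)  (outside ∷ q) = cong suc (∣p∪q∣+∣p∩q∣≡∣p∣+∣q∣ p q)
∣p∪q∣+∣p∩q∣≡∣p∣+∣q∣ (outside ∷ p) (inside ∷ q)  =
  trans (cong suc (∣p∪q∣+∣p∩q∣≡∣p∣+∣q∣ p q)) (sym (+-suc ∣ p ∣ ∣ q ∣))
∣p∪q∣+∣p∩q∣≡∣p∣+∣q∣ (outside ∷ p) (outside ∷ q) = ∣p∪q∣+∣p∩q∣≡∣p∣+∣q∣ p q

module SubtupleSums {c ℓ : Level} (F : Field c ℓ) {m ℓm : Level}
                    (M : Module (Field.commutativeRing F) m ℓm)
                    {p : Level} {N : ℕ} (n : Fin N → LinAlg.Subspace F M p) where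

  open import Relation.Unary using (_⊆_)

  open Module M
  open LinAlg F M
  open Tuple n
  open FiniteSpans F M using (∑-cong; ∑-distrib-+ᴹ; _+ᴾ_; ⊆lincombs⇒⊆Span; Range-⊆; grassmann-≤)

  ⟨⟩-mono : ∀ {S U} → S Subset.⊆ U → ⟨ S ⟩ ⊆ ⟨ U ⟩
  ⟨⟩-mono {S} {U} S⊆U (w , w∈ , w≈0 , x≈∑w) =
    w , w∈′ , (λ i i∉U → w≈0 i (λ i∈S → i∉U (S⊆U i∈S))) , x≈∑w
    where
    w∈′ : ∀ i → i ∈ U → mem (n i) (w i)
    w∈′ i _ with i ∈? S
    ... | yes i∈S = w∈ i i∈S
    ... | no  i∉S = resp (n i) (≈ᴹ-sym (w≈0 i i∉S)) (zero∈ (n i))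

  ⟨∪⟩⊆⟨⟩+⟨⟩ : ∀ k h → ⟨ k ∪ h ⟩ ⊆ ⟨ k ⟩ +ᴾ ⟨ h ⟩
  ⟨∪⟩⊆⟨⟩+⟨⟩ k h (w , w∈ , w≈0 , x≈∑w) =
    ∑ wk , ∑ wh , (wk , wk∈ , wk≈0 , ≈ᴹ-refl) , (wh , wh∈ , wh≈0 , ≈ᴹ-refl) ,
    ≈ᴹ-trans x≈∑w (≈ᴹ-trans (∑-cong w≈wk+wh) (∑-distrib-+ᴹ wk wh))
    where
    wk wh : Fin N → Carrierᴹ
    wk i with i ∈? k
    ... | yes _ = w i
    ... | no  _ = 0ᴹ
    wh i with i ∈? k
    ... | yes _ = 0ᴹ
    ... | no  _ = w i
    w≈wk+wh : ∀ i → w i ≈ᴹ wk i +ᴹ wh i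
    w≈wk+wh i with i ∈? k
    ... | yes _ = ≈ᴹ-sym (+ᴹ-identityʳ (w i))
    ... | no  _ = ≈ᴹ-sym (+ᴹ-identityˡ (w i))
    wk∈ : ∀ i → i ∈ k → mem (n i) (wk i)
    wk∈ i i∈k with i ∈? k
    ... | yes _   = w∈ i (x∈p∪q⁺ (inj₁ i∈k))
    ... | no  i∉k = contradiction i∈k i∉k
    wk≈0 : ∀ i → i ∉ k → wk i ≈ᴹ 0ᴹ
    wk≈0 i i∉k with i ∈? k
    ... | yes i∈k = contradiction i∈k i∉k
    ... | no  _   = ≈ᴹ-refl
    wh∈ : ∀ i → i ∈ h → mem (n i) (wh i)
    wh∈ i i∈h with i ∈? k
    ... | yes _ = zero∈ (n i)
    ... | no  _ = w∈ i (x∈p∪q⁺ (inj₂ i∈h))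
    wh≈0 : ∀ i → i ∉ h → wh i ≈ᴹ 0ᴹ
    wh≈0 i i∉h with i ∈? k
    ... | yes _   = ≈ᴹ-refl
    ... | no  i∉k = w≈0 i (λ i∈k∪h → [ i∉k , i∉h ] (x∈p∪q⁻ k h i∈k∪h))

  dim⟨∪⟩+dim⟨∩⟩≤ : ∀ {k h a b d d′} →
                   HasDim ⟨ k ⟩ a → HasDim ⟨ h ⟩ b →
                   HasDim ⟨ k ∪ h ⟩ d → HasDim ⟨ k ∩ h ⟩ d′ →
                   d + d′ ≤ a + b
  dim⟨∪⟩+dim⟨∩⟩≤ {k} {h} (uK , _ , _ , ⟨k⟩⊆) (uH , _ , _ , ⟨h⟩⊆)
                          (_ , y∈ , y-indep , _) (_ , z∈ , z-indep , _) =
    grassmann-≤ uK uH (⊆lincombs⇒⊆Span ⟨k⟩⊆) (⊆lincombs⇒⊆Span ⟨h⟩⊆)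
      y-indep (⟨∪⟩⊆⟨⟩+⟨⟩ k h ∘ Range-⊆ y∈)
      z-indep (⟨⟩-mono (p∩q⊆p k h) ∘ Range-⊆ z∈) (⟨⟩-mono (p∩q⊆q k h) ∘ Range-⊆ z∈)

lemma1p28 : ∀ {c ℓ m ℓm p : Level} (F : Field c ℓ)
    (M : Module (Field.commutativeRing F) m ℓm) →
    LinAlg.FiniteDimensional F M →
    (N : ℕ) (n : Fin N → LinAlg.Subspace F M p) →
    LinAlg.Tuple.LinIndep F M n ⊤ →
    (k h : Subset N) →
    LinAlg.Tuple.IsBK F M n k →
    LinAlg.Tuple.IsBK F M n h →
    LinAlg.Tuple.IsBK F M n (k ∪ h) × LinAlg.Tuple.IsBK F M n (k ∩ h)
lemma1p28 F M _ N n n-indep k h (_ , dim⟨k⟩) (_ , dim⟨h⟩)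
  with n-indep (k ∪ h) ⊆⊤ | n-indep (k ∩ h) ⊆⊤
... | d , dim⟨k∪h⟩ , ∣k∪h∣≤d | d′ , dim⟨k∩h⟩ , ∣k∩h∣≤d′
  with ≤-+-squeeze ∣k∪h∣≤d ∣k∩h∣≤d′
         (subst (d + d′ ≤_) (sym (∣p∪q∣+∣p∩q∣≡∣p∣+∣q∣ k h))
           (SubtupleSums.dim⟨∪⟩+dim⟨∩⟩≤ F M n dim⟨k⟩ dim⟨h⟩ dim⟨k∪h⟩ dim⟨k∩h⟩))
... | refl , refl = (subtuple-indep , dim⟨k∪h⟩) , (subtuple-indep , dim⟨k∩h⟩)
  where
  subtuple-indep : ∀ {S} → LinAlg.Tuple.LinIndep F M n S
  subtuple-indep T _ = n-indep T ⊆⊤
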